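{- Let $G\le\mathrm{Sym}(\Omega)$ be a transitive permutation group on a finite set $\Omega$ whose one-point stabilizer $H=G_\alpha$ is a TI-subgroup of $G$, and let $\mathcal{X}=(\Omega,S)$ be the coherent configuration associated with $G$. Let $c$ be the indistinguishing number of $\mathcal{X}$, $m=|S_1|$, and $k$ the maximum valency of a basis relation of $\mathcal{X}$. Then $c\le mk$. Moreover, this bound is tight: there exist such $G$ (transitive with TI one-point stabilizer) for which $c=mk$.
   Context: The coherent configuration associated with $G$ is $(\Omega,S)$ with $S$ the set of orbits of $G$ acting componentwise on $\Omega\times\Omega$. For $s\in S$, $\beta s=\{\gamma:(\beta,\gamma)\in s\}$ and the valency is $n_s=|\beta s|$; $S_1=\{s\in S: n_s=1\}$. Intersection numbers: $c_{rs}^t=|\beta r\cap\gamma s^*|$ for $(\beta,\gamma)\in t$, where $s^*=\{(\delta,\varepsilon):(\varepsilon,\delta)\in s\}$. The indistinguishing number of $\mathcal{X}$ is $c=\max_{r\in S\setminus\{1_\Omega\}}\sum_{s\in S}c_{ss^*}^r$, where $1_\Omega$ is the diagonal. A subgroup $H\le G$ is a TI-subgroup if $H^g\cap H\in\{H,1\}$ for all $g\in G$. -}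

module Defs where

open import Data.Nat using (ℕ; zero; suc; _+_; _⊔_)
open import Data.Fin using (Fin)
open import Data.Fin.Properties using (_≟_)
open import Data.Fin.Permutation using (Permutation′; _⟨$⟩ʳ_; _⟨$⟩ˡ_)
open import Data.List using (List; []; _∷_; allFin; map; concatMap; filter; length; foldr)
open import Data.Nat.ListAction using (sum)
open import Data.List.Relation.Unary.Any using (Any; any?)
open import Data.Product using (_×_; _,_; proj₁; proj₂)
open import Relation.Binary.PropositionalEquality using (_≡_)
open import Relation.Nullary using (Dec; yes; no; ¬_; _×-dec_)
open import Relation.Nullary.Decidable using (⌊_⌋)
open import Data.Bool using (Bool; true; false; if_then_else_)
open import Data.Sum using (_⊎_)

-- A finite subset G of Sym(Ω), Ω = Fin n, is given as a list of permutations.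
-- Membership is up to extensional equality of permutations.
Perm : ℕ → Set
Perm n = Permutation′ n

_≗ₚ_ : ∀ {n} → Perm n → Perm n → Set
σ ≗ₚ τ = ∀ i → σ ⟨$⟩ʳ i ≡ τ ⟨$⟩ʳ i

_∈G_ : ∀ {n} → (Fin n → Fin n) → List (Perm n) → Set
f ∈G G = Any (λ g → ∀ i → g ⟨$⟩ʳ i ≡ f i) G

record IsPermGroup {n : ℕ} (G : List (Perm n)) : Set where
  field
    has-id  : (λ i → i) ∈G G
    has-mul : ∀ g h → Any (g ≗ₚ_) G → Any (h ≗ₚ_) G → (λ i → g ⟨$⟩ʳ (h ⟨$⟩ʳ i)) ∈G G
    has-inv : ∀ g → Any (g ≗ₚ_) G → (λ i → g ⟨$⟩ˡ i) ∈G G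

_∈_ : ∀ {n} → Perm n → List (Perm n) → Set
g ∈ G = Any (g ≗ₚ_) G

Transitive : ∀ {n} → List (Perm n) → Set
Transitive {n} G = ∀ (β γ : Fin n) → Any (λ g → g ⟨$⟩ʳ β ≡ γ) G

InStab : ∀ {n} → Fin n → Perm n → Set
InStab α x = x ⟨$⟩ʳ α ≡ α

-- x ∈ H^g = g⁻¹ H g  iff  g x g⁻¹ ∈ H
InConj : ∀ {n} → Fin n → Perm n → Perm n → Set
InConj α g x = g ⟨$⟩ʳ (x ⟨$⟩ʳ (g ⟨$⟩ˡ α)) ≡ α

-- H = G_α is a TI-subgroup: for every g ∈ G, H^g ∩ H = H or H^g ∩ H = 1
IsTIStab : ∀ {n} → List (Perm n) → Fin n → Set
IsTIStab {n} G α = ∀ g → g ∈ G →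
    (∀ x → x ∈ G → InStab α x → InConj α g x)
  ⊎ (∀ x → x ∈ G → InStab α x → InConj α g x → ∀ (i : Fin n) → x ⟨$⟩ʳ i ≡ i)

Pair : ℕ → Set
Pair n = Fin n × Fin n

allPairs : ∀ n → List (Pair n)
allPairs n = concatMap (λ β → map (λ γ → (β , γ)) (allFin n)) (allFin n)

SameOrb : ∀ {n} → List (Perm n) → Pair n → Pair n → Set
SameOrb G (β , γ) (δ , ε) = Any (λ g → (g ⟨$⟩ʳ β ≡ δ) × (g ⟨$⟩ʳ γ ≡ ε)) G

sameOrb? : ∀ {n} (G : List (Perm n)) p q → Dec (SameOrb G p q)
sameOrb? G (β , γ) (δ , ε) = any? (λ g → (g ⟨$⟩ʳ β ≟ δ) ×-dec (g ⟨$⟩ʳ γ ≟ ε)) G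

inRel : ∀ {n} → List (Perm n) → Pair n → Pair n → Bool
inRel G r p = ⌊ sameOrb? G r p ⌋

firstInOrbit : ∀ {n} → List (Perm n) → Pair n → List (Pair n) → Bool
firstInOrbit G p [] = false
firstInOrbit G p (q ∷ qs) = if inRel G q p then ⌊ (proj₁ p ≟ proj₁ q) ×-dec (proj₂ p ≟ proj₂ q) ⌋
                            else firstInOrbit G p qs

-- S: the basis relations, each represented by the canonical (first) pair of the orbit.
-- Each orbit occurs exactly once in this list.
basis : ∀ {n} → List (Perm n) → List (Pair n)
basis {n} G = filter (λ p → firstInOrbit G p (allPairs n) Data.Bool.≟ true) (allPairs n)

count : ∀ {n} → (Fin n → Bool) → ℕ
count {n} f = length (filter (λ i → f i Data.Bool.≟ true) (allFin n))

maxList : List ℕ → ℕ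
maxList = foldr _⊔_ 0

valency : ∀ {n} → List (Perm n) → Pair n → ℕ
valency G (β , γ) = count (λ δ → inRel G (β , γ) (β , δ))

-- c_{rs}^t = |β r ∩ γ s*| for (β,γ) ∈ t (t given by its representative (β,γ));
-- δ ∈ γ s*  iff  (γ,δ) ∈ s* ... i.e. (δ,γ) ∈ s*  iff  (γ,δ) ∈ s.
intersectionNumber : ∀ {n} → List (Perm n) → (r s* t : Pair n) → ℕ
intersectionNumber G r s* (β , γ) =
  count (λ δ → inRel G r (β , δ) Data.Bool.∧ inRel G s* (δ , γ))

star : ∀ {n} → Pair n → Pair n
star (β , γ) = (γ , β)

-- the diagonal 1_Ω (a single basis relation since G is transitive) :
-- r ≠ 1_Ω iff its representative is an off-diagonal pair
isDiag : ∀ {n} → Pair n → Bool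
isDiag (β , γ) = ⌊ β ≟ γ ⌋

-- indistinguishing number c = max_{r ∈ S, r ≠ 1_Ω} Σ_{s ∈ S} c_{ss*}^r  (max ∅ = 0)
indist : ∀ {n} → List (Perm n) → ℕ
indist G = maxList (map (λ r → sum (map (λ s → intersectionNumber G s (star s) r) (basis G)))
                        (filter (λ r → isDiag r Data.Bool.≟ false) (basis G)))

numThin : ∀ {n} → List (Perm n) → ℕ
numThin G = length (filter (λ s → valency G s Data.Nat.≟ 1) (basis G))

maxValency : ∀ {n} → List (Perm n) → ℕ
maxValency G = maxList (map (valency G) (basis G))

-- Fix r = (β , γ) with β ≠ γ. The sum Σ_s c_{ss*}^r counts the points δ such that (β , δ) and
-- (γ , δ) lie in one orbit, i.e. δ is fixed by some g ∈ G with g β = γ. By the TI property any two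
-- point stabilisers are either nested or meet trivially. Given one such δ₀, fixed by g₀, the
-- stabilisers of δ₀ and γ meet trivially (g₀ fixes δ₀ but not γ), so an element g with g β = γ
-- is determined by y = g⁻¹ δ₀, a point of the row β s of the basis relation s ∋ (β , δ₀): at most
-- k values of y. All δ over the same y are fixed by the same g, which moves β; hence G_δ₁ ⊆ G_δ
-- for a fixed δ₁ of the fibre, so (δ₁ , δ) lies in a thin relation, and distinct δ give distinct
-- thin relations: at most m points per fibre. Equality holds for A₄ acting on the
-- six edges of a tetrahedron.

module Submission where

open import Defs hiding (_∈_)
open import Data.Bool using (true; false; _∧_)
import Data.Bool as Bool
open import Data.Bool.Properties using (T-≡)
open import Data.Empty using (⊥-elim)
open import Data.Fin using (Fin; zero)
open import Data.Fin.Properties using (_≟_)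
import Data.Fin.Properties as Fin
open import Data.Fin.Permutation using (permutation; _⟨$⟩ʳ_; _⟨$⟩ˡ_; inverseˡ; inverseʳ)
open import Data.List using (List; []; _∷_; map; filter; length; allFin; concatMap; cartesianProduct; _++_)
open import Data.List.Membership.Propositional using (_∈_; find; lose)
open import Data.List.Membership.Propositional.Properties
  using (∈-allFin; ∈-map⁺; ∈-map⁻; ∈-filter⁺; ∈-filter⁻; ∈-cartesianProduct⁺)
open import Data.List.Properties using (map-cong; foldr-preservesᵇ)
open import Data.List.Relation.Unary.All as All using (All; []; _∷_; all?)
open import Data.List.Relation.Unary.AllPairs using ([]; _∷_)
open import Data.List.Relation.Unary.Any as Any using (Any; here; there; any?)
open import Data.List.Relation.Unary.Unique.Propositional using (Unique)
open import Data.List.Relation.Unary.Unique.Propositional.Properties using (allFin⁺; cartesianProduct⁺; filter⁺)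
open import Data.Nat using (ℕ; zero; suc; _+_; _*_; _≤_; _≤?_; z≤n; s≤s)
import Data.Nat as ℕ
open import Data.Nat.ListAction using (sum)
open import Data.Nat.Properties
  using (≤-trans; ≤-reflexive; ≤-antisym; +-mono-≤; m≤n+m; m≤n⇒m≤1+n; ≮⇒≥; *-identityʳ; *-comm; *-monoˡ-≤;
         ⊔-lub; m≤m⊔n; m≤n⊔m; +-commutativeSemigroup; module ≤-Reasoning)
open import Algebra.Properties.CommutativeSemigroup +-commutativeSemigroup using () renaming (interchange to +-interchange)
open import Data.Product using (Σ; Σ-syntax; ∃-syntax; _×_; _,_; proj₁; proj₂; swap)
open import Data.Sum using (_⊎_; inj₁; inj₂)
open import Data.Vec using (Vec; lookup)
open import Function using (_∘_; _⇔_; mk⇔; module Equivalence)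
open import Level using (0ℓ)
open import Relation.Binary.PropositionalEquality
open import Relation.Nullary using (Dec; yes; no; ¬_; contradiction; _×-dec_; _⊎-dec_; _→-dec_)
open import Relation.Nullary.Decidable using (True; isYes; isYes≗does; dec-true; dec-false; toWitness; from-yes)
import Relation.Nullary.Decidable as Dec
open import Relation.Unary using (Pred; Decidable; _⊆′_; _∩_)

private variable
  A B : Set

𝟙 : {P : Set} → Dec P → ℕ
𝟙 (yes _) = 1
𝟙 (no _)  = 0

module _ {P : Pred A 0ℓ} (P? : Decidable P) where

  length-filter≡sum-𝟙 : ∀ xs → length (filter P? xs) ≡ sum (map (𝟙 ∘ P?) xs)
  length-filter≡sum-𝟙 []       = refl
  length-filter≡sum-𝟙 (x ∷ xs) with P? x
  ... | yes _ = cong suc (length-filter≡sum-𝟙 xs)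
  ... | no  _ = length-filter≡sum-𝟙 xs

  1≤length-filter : ∀ {x xs} → x ∈ xs → P x → 1 ≤ length (filter P? xs)
  1≤length-filter {xs = y ∷ xs} x∈ px with P? y
  ... | yes _ = s≤s z≤n
  1≤length-filter (here refl)  px | no ¬py = ⊥-elim (¬py px)
  1≤length-filter (there x∈)   px | no _   = 1≤length-filter x∈ px

  length-filter≤1 : ∀ {xs} → Unique xs → (∀ {x y} → x ∈ xs → y ∈ xs → P x → P y → x ≡ y) →
                    length (filter P? xs) ≤ 1
  length-filter≤1 {[]}     _            _    = z≤n
  length-filter≤1 {x ∷ xs} (x∉ ∷ uniq) same with P? x
  ... | no _   = length-filter≤1 uniq (λ x∈ y∈ → same (there x∈) (there y∈))
  ... | yes px = s≤s (≤-reflexive (none xs x∉ (λ y∈ → same (here refl) (there y∈) px)))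
    where
    none : ∀ ys → All (x ≢_) ys → (∀ {y} → y ∈ ys → P y → x ≡ y) → length (filter P? ys) ≡ 0
    none []       _            _ = refl
    none (y ∷ ys) (x≢y ∷ x∉ys) eq with P? y
    ... | yes py = ⊥-elim (x≢y (eq (here refl) py))
    ... | no  _  = none ys x∉ys (eq ∘ there)

  witness-of-1≤length-filter : ∀ xs → 1 ≤ length (filter P? xs) → ∃[ x ] x ∈ xs × P x
  witness-of-1≤length-filter xs pos with filter P? xs in eq
  ... | x ∷ _ = x , ∈-filter⁻ P? (subst (x ∈_) (sym eq) (here refl))

  length-filter≤-from-witness : ∀ xs {m} → (∀ {x} → x ∈ xs → P x → length (filter P? xs) ≤ m) →
                                length (filter P? xs) ≤ m
  length-filter≤-from-witness xs bound with 1 ≤? length (filter P? xs)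
  ... | yes pos = let _ , x∈ , px = witness-of-1≤length-filter xs pos in bound x∈ px
  ... | no ¬pos = ≤-trans (≮⇒≥ ¬pos) z≤n

module _ {P Q : Pred A 0ℓ} (P? : Decidable P) (Q? : Decidable Q) where

  length-filter-mono : ∀ xs → (∀ {x} → x ∈ xs → P x → Q x) → length (filter P? xs) ≤ length (filter Q? xs)
  length-filter-mono []       _   = z≤n
  length-filter-mono (x ∷ xs) P⇒Q with P? x | Q? x
  ... | yes px | yes _  = s≤s (length-filter-mono xs (P⇒Q ∘ there))
  ... | yes px | no ¬qx = ⊥-elim (¬qx (P⇒Q (here refl) px))
  ... | no _   | yes _  = m≤n⇒m≤1+n (length-filter-mono xs (P⇒Q ∘ there))
  ... | no _   | no _   = length-filter-mono xs (P⇒Q ∘ there)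

sum-map-+ : ∀ (f g : A → ℕ) xs → sum (map (λ x → f x + g x) xs) ≡ sum (map f xs) + sum (map g xs)
sum-map-+ f g []       = refl
sum-map-+ f g (x ∷ xs) rewrite sum-map-+ f g xs = +-interchange (f x) (g x) _ _

sum-map-0 : ∀ (xs : List A) → sum (map (λ _ → 0) xs) ≡ 0
sum-map-0 []       = refl
sum-map-0 (_ ∷ xs) = sum-map-0 xs

sum-map-comm : ∀ (f : A → B → ℕ) xs ys →
               sum (map (λ x → sum (map (f x) ys)) xs) ≡ sum (map (λ y → sum (map (λ x → f x y) xs)) ys)
sum-map-comm f []       ys = sym (sum-map-0 ys)
sum-map-comm f (x ∷ xs) ys = begin
  sum (map (f x) ys) + sum (map (λ x → sum (map (f x) ys)) xs)      ≡⟨ cong (sum (map (f x) ys) +_) (sum-map-comm f xs ys) ⟩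
  sum (map (f x) ys) + sum (map (λ y → sum (map (λ x → f x y) xs)) ys) ≡⟨ sym (sum-map-+ (f x) _ ys) ⟩
  sum (map (λ y → f x y + sum (map (λ x → f x y) xs)) ys)            ∎
  where open ≡-Reasoning

module _ {R : A → B → Set} (R? : ∀ x y → Dec (R x y)) where

  sum-length-filter-comm : ∀ xs ys →
    sum (map (λ x → length (filter (R? x) ys)) xs) ≡ sum (map (λ y → length (filter (λ x → R? x y) xs)) ys)
  sum-length-filter-comm xs ys = begin
    sum (map (λ x → length (filter (R? x) ys)) xs)          ≡⟨ cong sum (map-cong (λ x → length-filter≡sum-𝟙 (R? x) ys) xs) ⟩
    sum (map (λ x → sum (map (𝟙 ∘ R? x) ys)) xs)            ≡⟨ sum-map-comm (λ x y → 𝟙 (R? x y)) xs ys ⟩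
    sum (map (λ y → sum (map (λ x → 𝟙 (R? x y)) xs)) ys)    ≡⟨ cong sum (map-cong (λ y → sym (length-filter≡sum-𝟙 (λ x → R? x y) xs)) ys) ⟩
    sum (map (λ y → length (filter (λ x → R? x y) xs)) ys)  ∎
    where open ≡-Reasoning

module _ {P : Pred A 0ℓ} (P? : Decidable P) where

  length-filter≤sum : ∀ (f : A → ℕ) xs → (∀ {x} → x ∈ xs → P x → 1 ≤ f x) → length (filter P? xs) ≤ sum (map f xs)
  length-filter≤sum f []       _   = z≤n
  length-filter≤sum f (x ∷ xs) pos with P? x
  ... | yes px = +-mono-≤ (pos (here refl) px) (length-filter≤sum f xs (pos ∘ there))
  ... | no  _  = ≤-trans (length-filter≤sum f xs (pos ∘ there)) (m≤n+m _ (f x))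

  sum≤length-filter* : ∀ (f : A → ℕ) m xs → (∀ {x} → x ∈ xs → f x ≤ m) → (∀ {x} → x ∈ xs → 1 ≤ f x → P x) →
                       sum (map f xs) ≤ length (filter P? xs) * m
  sum≤length-filter* f m []       _     _   = z≤n
  sum≤length-filter* f m (x ∷ xs) bound pos with P? x
  ... | yes _  = +-mono-≤ (bound (here refl)) (sum≤length-filter* f m xs (bound ∘ there) (pos ∘ there))
  ... | no ¬px with f x in eq
  ...   | zero  = sum≤length-filter* f m xs (bound ∘ there) (pos ∘ there)
  ...   | suc _ = ⊥-elim (¬px (pos (here refl) (≤-trans (s≤s z≤n) (≤-reflexive (sym eq)))))

double-counting : ∀ {P : Pred A 0ℓ} {Q : Pred B 0ℓ} {R : A → B → Set}
  (P? : Decidable P) (Q? : Decidable Q) (R? : ∀ x y → Dec (R x y)) xs ys m →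
  (∀ {x} → x ∈ xs → P x → ∃[ y ] y ∈ ys × Q y × R x y) →
  (∀ {y} → y ∈ ys → Q y → length (filter (λ x → R? x y) xs) ≤ m) →
  length (filter P? xs) ≤ length (filter Q? ys) * m
double-counting {P = P} {Q} {R} P? Q? R? xs ys m cover fibre = begin
  length (filter P? xs)                                          ≤⟨ length-filter≤sum P? _ xs incident ⟩
  sum (map (λ x → length (filter (λ y → QR? y x) ys)) xs)        ≡⟨ sum-length-filter-comm (λ x y → QR? y x) xs ys ⟩
  sum (map (λ y → length (filter (QR? y) xs)) ys)                ≤⟨ sum≤length-filter* Q? _ m ys fibre′ (λ _ → Q-of-incident) ⟩
  length (filter Q? ys) * m                                      ∎
  where
  open ≤-Reasoning
  QR? : ∀ y x → Dec (Q y × R x y)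
  QR? y x = Q? y ×-dec R? x y

  incident : ∀ {x} → x ∈ xs → P x → 1 ≤ length (filter (λ y → QR? y x) ys)
  incident x∈ px with cover x∈ px
  ... | y , y∈ , qy , rxy = 1≤length-filter (λ y → QR? y _) y∈ (qy , rxy)

  fibre′ : ∀ {y} → y ∈ ys → length (filter (QR? y) xs) ≤ m
  fibre′ {y} y∈ = length-filter≤-from-witness (QR? y) xs λ _ (qy , _) →
    ≤-trans (length-filter-mono (QR? y) (λ x → R? x y) xs (λ _ → proj₂)) (fibre y∈ qy)

  Q-of-incident : ∀ {y} → 1 ≤ length (filter (QR? y) xs) → Q y
  Q-of-incident pos = let _ , _ , qy , _ = witness-of-1≤length-filter (QR? _) xs pos in qy

concatMap-pairs : ∀ {A B : Set} (xs : List A) (ys : List B) →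
                  concatMap (λ x → map (x ,_) ys) xs ≡ cartesianProduct xs ys
concatMap-pairs []       ys = refl
concatMap-pairs (x ∷ xs) ys = cong (map (x ,_) ys ++_) (concatMap-pairs xs ys)

∈-allPairs : ∀ {n} (p : Pair n) → p ∈ allPairs n
∈-allPairs {n} (β , γ) = subst ((β , γ) ∈_) (sym (concatMap-pairs (allFin n) (allFin n)))
                                (∈-cartesianProduct⁺ (∈-allFin β) (∈-allFin γ))

allPairs-unique : ∀ n → Unique (allPairs n)
allPairs-unique n = subst Unique (sym (concatMap-pairs (allFin n) (allFin n)))
                          (cartesianProduct⁺ (allFin⁺ n) (allFin⁺ n))

InConj⇔ : ∀ {n} {α b : Fin n} (g x : Perm n) → g ⟨$⟩ʳ b ≡ α → InConj α g x ⇔ x ⟨$⟩ʳ b ≡ b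
InConj⇔ {b = b} g x refl rewrite inverseˡ g {b} =
  mk⇔ (λ e → trans (sym (inverseˡ g)) (trans (cong (g ⟨$⟩ˡ_) e) (inverseˡ g))) (cong (g ⟨$⟩ʳ_))

module PermGroup {n : ℕ} {G : List (Perm n)} (isGroup : IsPermGroup G) where
  open IsPermGroup isGroup

  Element : Set
  Element = Σ[ g ∈ Perm n ] g ∈ G

  infix 8 _⟨$⟩_
  _⟨$⟩_ : Element → Fin n → Fin n
  (g , _) ⟨$⟩ i = g ⟨$⟩ʳ i

  ∈⇒∈≗ : ∀ {g} → g ∈ G → g Defs.∈ G
  ∈⇒∈≗ = Any.map λ { refl _ → refl }

  element : ∀ {f} → f ∈G G → Σ[ g ∈ Element ] (∀ i → g ⟨$⟩ i ≡ f i)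
  element f∈ = let g , g∈ , g≗f = find f∈ in (g , g∈) , g≗f

  infixl 7 _∘ᴳ_
  _∘ᴳ_ : Element → Element → Element
  (g , g∈) ∘ᴳ (h , h∈) = proj₁ (element (has-mul g h (∈⇒∈≗ g∈) (∈⇒∈≗ h∈)))

  ∘ᴳ-⟨$⟩ : ∀ g h i → (g ∘ᴳ h) ⟨$⟩ i ≡ g ⟨$⟩ (h ⟨$⟩ i)
  ∘ᴳ-⟨$⟩ (g , g∈) (h , h∈) = proj₂ (element (has-mul g h (∈⇒∈≗ g∈) (∈⇒∈≗ h∈)))

  infix 9 _⁻¹
  _⁻¹ : Element → Element
  (g , g∈) ⁻¹ = proj₁ (element (has-inv g (∈⇒∈≗ g∈)))

  ⁻¹-⟨$⟩ : ∀ g i → g ⁻¹ ⟨$⟩ i ≡ proj₁ g ⟨$⟩ˡ i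
  ⁻¹-⟨$⟩ (g , g∈) = proj₂ (element (has-inv g (∈⇒∈≗ g∈)))

  ⁻¹-cancelˡ : ∀ g {i} → g ⁻¹ ⟨$⟩ (g ⟨$⟩ i) ≡ i
  ⁻¹-cancelˡ g = trans (⁻¹-⟨$⟩ g _) (inverseˡ (proj₁ g))

  ⁻¹-cancelʳ : ∀ g {i} → g ⟨$⟩ (g ⁻¹ ⟨$⟩ i) ≡ i
  ⁻¹-cancelʳ g = trans (cong (g ⟨$⟩_) (⁻¹-⟨$⟩ g _)) (inverseʳ (proj₁ g))

  ⁻¹-flip : ∀ g {i j} → g ⟨$⟩ i ≡ j → g ⁻¹ ⟨$⟩ j ≡ i
  ⁻¹-flip g refl = ⁻¹-cancelˡ g

  ⟨$⟩-injective : ∀ g {i j} → g ⟨$⟩ i ≡ g ⟨$⟩ j → i ≡ j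
  ⟨$⟩-injective g e = trans (sym (⁻¹-cancelˡ g)) (trans (cong (g ⁻¹ ⟨$⟩_) e) (⁻¹-cancelˡ g))

  1ᴳ : Element
  1ᴳ = proj₁ (element has-id)

  1ᴳ-⟨$⟩ : ∀ i → 1ᴳ ⟨$⟩ i ≡ i
  1ᴳ-⟨$⟩ = proj₂ (element has-id)

  infix 4 _~_
  _~_ : Pair n → Pair n → Set
  _~_ = SameOrb G

  ~-intro : ∀ g {β γ δ ε} → g ⟨$⟩ β ≡ δ → g ⟨$⟩ γ ≡ ε → (β , γ) ~ (δ , ε)
  ~-intro (g , g∈) e₁ e₂ = lose g∈ (e₁ , e₂)

  ~-elim : ∀ {β γ δ ε} → (β , γ) ~ (δ , ε) → Σ[ g ∈ Element ] g ⟨$⟩ β ≡ δ × g ⟨$⟩ γ ≡ ε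
  ~-elim o = let g , g∈ , e = find o in (g , g∈) , e

  ~-refl : ∀ {p} → p ~ p
  ~-refl {β , γ} = ~-intro 1ᴳ (1ᴳ-⟨$⟩ β) (1ᴳ-⟨$⟩ γ)

  ~-sym : ∀ {p q} → p ~ q → q ~ p
  ~-sym {β , γ} {δ , ε} o = let g , e₁ , e₂ = ~-elim o in ~-intro (g ⁻¹) (⁻¹-flip g e₁) (⁻¹-flip g e₂)

  ~-trans : ∀ {p q r} → p ~ q → q ~ r → p ~ r
  ~-trans {β , γ} {δ , ε} {ζ , η} o o′ =
    let g , gβ , gγ = ~-elim o ; h , hδ , hε = ~-elim o′ in
    ~-intro (h ∘ᴳ g) (trans (∘ᴳ-⟨$⟩ h g β) (trans (cong (h ⟨$⟩_) gβ) hδ))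
                     (trans (∘ᴳ-⟨$⟩ h g γ) (trans (cong (h ⟨$⟩_) gγ) hε))

  ~-swap : ∀ {β γ δ ε} → (β , γ) ~ (δ , ε) → (γ , β) ~ (ε , δ)
  ~-swap = Any.map swap

  inRel⇒~ : ∀ {p q} → inRel G p q ≡ true → p ~ q
  inRel⇒~ e = toWitness (Equivalence.from T-≡ e)

  ~⇒inRel : ∀ {p q} → p ~ q → inRel G p q ≡ true
  ~⇒inRel {p} {q} o = trans (isYes≗does (sameOrb? G p q)) (dec-true (sameOrb? G p q) o)

  ≁⇒inRel≡false : ∀ {p q} → ¬ p ~ q → inRel G p q ≡ false
  ≁⇒inRel≡false {p} {q} ¬o = trans (isYes≗does (sameOrb? G p q)) (dec-false (sameOrb? G p q) ¬o)

  private
    _≟ₚ_ : (p q : Pair n) → Dec (proj₁ p ≡ proj₁ q × proj₂ p ≡ proj₂ q)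
    p ≟ₚ q = (proj₁ p ≟ proj₁ q) ×-dec (proj₂ p ≟ proj₂ q)

  firstInOrbit-∷-~ : ∀ {p q} L → q ~ p → firstInOrbit G p (q ∷ L) ≡ isYes (p ≟ₚ q)
  firstInOrbit-∷-~ L o rewrite ~⇒inRel o = refl

  firstInOrbit-∷-≁ : ∀ {p q} L → ¬ q ~ p → firstInOrbit G p (q ∷ L) ≡ firstInOrbit G p L
  firstInOrbit-∷-≁ L ¬o rewrite ≁⇒inRel≡false ¬o = refl

  firstInOrbit-complete : ∀ {p} L → Any (_~ p) L → Σ[ q ∈ Pair n ] q ∈ L × q ~ p × firstInOrbit G q L ≡ true
  firstInOrbit-complete {p} (x ∷ L) x~p∈ with sameOrb? G x p | x~p∈
  ... | yes x~p | _ = x , here refl , x~p ,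
                      trans (firstInOrbit-∷-~ L ~-refl) (trans (isYes≗does (x ≟ₚ x)) (dec-true (x ≟ₚ x) (refl , refl)))
  ... | no x≁p | here x~p = contradiction x~p x≁p
  ... | no x≁p | there x~p∈′ =
    let q , q∈ , q~p , first = firstInOrbit-complete L x~p∈′ in
    q , there q∈ , q~p , trans (firstInOrbit-∷-≁ L λ x~q → x≁p (~-trans x~q q~p)) first

  firstInOrbit-unique : ∀ L {q q′} → firstInOrbit G q L ≡ true → firstInOrbit G q′ L ≡ true → q ~ q′ → q ≡ q′
  firstInOrbit-unique (x ∷ L) {q} {q′} first first′ q~q′ = go (sameOrb? G x q)
    where
    ≡x : ∀ {r} → x ~ r → firstInOrbit G r (x ∷ L) ≡ true → r ≡ x
    ≡x x~r e = let e₁ , e₂ = toWitness (Equivalence.from T-≡ (trans (sym (firstInOrbit-∷-~ L x~r)) e)) in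
               cong₂ _,_ e₁ e₂

    go : Dec (x ~ q) → q ≡ q′
    go (yes x~q) = trans (≡x x~q first) (sym (≡x (~-trans x~q q~q′) first′))
    go (no x≁q)  = firstInOrbit-unique L
      (trans (sym (firstInOrbit-∷-≁ L x≁q)) first)
      (trans (sym (firstInOrbit-∷-≁ L λ x~q′ → x≁q (~-trans x~q′ (~-sym q~q′)))) first′) q~q′

  IsCanonical : Pair n → Set
  IsCanonical p = firstInOrbit G p (allPairs n) ≡ true

  isCanonical? : ∀ p → Dec (IsCanonical p)
  isCanonical? p = firstInOrbit G p (allPairs n) Bool.≟ true

  ∈basis⇔ : ∀ {p} → p ∈ basis G ⇔ IsCanonical p
  ∈basis⇔ = mk⇔ (λ p∈ → proj₂ (∈-filter⁻ isCanonical? {xs = allPairs n} p∈)) (∈-filter⁺ isCanonical? (∈-allPairs _))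

  basis-complete : ∀ p → Σ[ q ∈ Pair n ] q ∈ basis G × q ~ p
  basis-complete p =
    let q , _ , q~p , canonical = firstInOrbit-complete (allPairs n) (lose (∈-allPairs p) ~-refl) in
    q , Equivalence.from ∈basis⇔ canonical , q~p

  basis-unique : ∀ {q q′} → q ∈ basis G → q′ ∈ basis G → q ~ q′ → q ≡ q′
  basis-unique q∈ q′∈ = firstInOrbit-unique (allPairs n) (Equivalence.to ∈basis⇔ q∈) (Equivalence.to ∈basis⇔ q′∈)

  basis-nodup : Unique (basis G)
  basis-nodup = filter⁺ isCanonical? (allPairs-unique n)

  Stab : Fin n → Pred Element 0ℓ
  Stab a g = g ⟨$⟩ a ≡ a

  Trivial : Pred Element 0ℓ
  Trivial g = ∀ i → g ⟨$⟩ i ≡ i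

  Stab⊆? : ∀ a b → Dec (Stab a ⊆′ Stab b)
  Stab⊆? a b = Dec.map (mk⇔ (λ all g → All.lookup all (proj₂ g)) (λ sub → All.tabulate λ g∈ → sub (_ , g∈)))
                       (All.all? (λ g → (g ⟨$⟩ʳ a ≟ a) →-dec (g ⟨$⟩ʳ b ≟ b)) G)

  conj : Element → Element → Element
  conj t x = t ∘ᴳ x ∘ᴳ t ⁻¹

  conj-⟨$⟩ : ∀ t x i → conj t x ⟨$⟩ (t ⟨$⟩ i) ≡ t ⟨$⟩ (x ⟨$⟩ i)
  conj-⟨$⟩ t x i = begin
    (t ∘ᴳ x ∘ᴳ t ⁻¹) ⟨$⟩ (t ⟨$⟩ i)        ≡⟨ ∘ᴳ-⟨$⟩ (t ∘ᴳ x) (t ⁻¹) _ ⟩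
    (t ∘ᴳ x) ⟨$⟩ (t ⁻¹ ⟨$⟩ (t ⟨$⟩ i))     ≡⟨ cong ((t ∘ᴳ x) ⟨$⟩_) (⁻¹-cancelˡ t) ⟩
    (t ∘ᴳ x) ⟨$⟩ i                         ≡⟨ ∘ᴳ-⟨$⟩ t x i ⟩
    t ⟨$⟩ (x ⟨$⟩ i)                        ∎
    where open ≡-Reasoning

  Stab-conj : ∀ t x i → Stab (t ⟨$⟩ i) (conj t x) ⇔ Stab i x
  Stab-conj t x i = mk⇔ (λ fix → ⟨$⟩-injective t (trans (sym (conj-⟨$⟩ t x i)) fix))
                        (λ fix → trans (conj-⟨$⟩ t x i) (cong (t ⟨$⟩_) fix))

  Trivial-conj : ∀ t x → Trivial (conj t x) → Trivial x
  Trivial-conj t x triv i = Equivalence.to (Stab-conj t x i) (triv (t ⟨$⟩ i))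

  module _ (transitive : Transitive G) where

    mover : ∀ β γ → Σ[ g ∈ Element ] g ⟨$⟩ β ≡ γ
    mover β γ = let g , g∈ , e = find (transitive β γ) in (g , g∈) , e

    module _ {α} (ti : IsTIStab G α) where

      Stab-α-TI : ∀ b → Stab α ⊆′ Stab b ⊎ Stab α ∩ Stab b ⊆′ Trivial
      Stab-α-TI b with mover b α
      ... | (g , g∈) , gb with ti g (∈⇒∈≗ g∈)
      ... | inj₁ H = inj₁ λ { (x , x∈) xα → Equivalence.to (InConj⇔ g x gb) (H x (∈⇒∈≗ x∈) xα) }
      ... | inj₂ H = inj₂ λ { (x , x∈) (xα , xb) → H x (∈⇒∈≗ x∈) xα (Equivalence.from (InConj⇔ g x gb) xb) }

      stabilisers-TI : ∀ a b → Stab a ⊆′ Stab b ⊎ Stab a ∩ Stab b ⊆′ Trivial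
      stabilisers-TI a b with mover a α
      ... | t , refl with Stab-α-TI (t ⟨$⟩ b)
      ... | inj₁ H = inj₁ λ x xa → Equivalence.to (Stab-conj t x b) (H (conj t x) (Equivalence.from (Stab-conj t x a) xa))
      ... | inj₂ H = inj₂ λ x (xa , xb) → Trivial-conj t x
                       (H (conj t x) (Equivalence.from (Stab-conj t x a) xa , Equivalence.from (Stab-conj t x b) xb))

≤-maxList : ∀ {x xs} → x ∈ xs → x ≤ maxList xs
≤-maxList (here refl)  = m≤m⊔n _ _
≤-maxList (there x∈xs) = ≤-trans (≤-maxList x∈xs) (m≤n⊔m _ _)

maxList≤ : ∀ {xs m} → (∀ {x} → x ∈ xs → x ≤ m) → maxList xs ≤ m
maxList≤ bound = foldr-preservesᵇ ⊔-lub z≤n (All.tabulate bound)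

isDiag≡false⇒≢ : ∀ {n} {β γ : Fin n} → isDiag (β , γ) ≡ false → β ≢ γ
isDiag≡false⇒≢ {β = β} {γ} off β≡γ with trans (sym off) (trans (isYes≗does (β ≟ γ)) (dec-true (β ≟ γ) β≡γ))
... | ()

∧-true : ∀ {x y} → x ∧ y ≡ true → x ≡ true × y ≡ true
∧-true {true} {true} _ = refl , refl

module Configuration {n} {G : List (Perm n)} (isGroup : IsPermGroup G) where
  open PermGroup isGroup

  row? : ∀ p δ → Dec (inRel G p (proj₁ p , δ) ≡ true)
  row? p δ = inRel G p (proj₁ p , δ) Bool.≟ true

  valency-mono : ∀ {a b c d} → (a , b) ~ (c , d) → valency G (a , b) ≤ valency G (c , d)
  valency-mono {a} {b} {c} {d} ab~cd = ≤-trans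
    (double-counting (row? (a , b)) (row? (c , d)) (λ δ y → u ⟨$⟩ δ ≟ y) (allFin n) (allFin n) 1 cover fibre)
    (≤-reflexive (*-identityʳ _))
    where
    u = proj₁ (~-elim ab~cd)
    ua = proj₁ (proj₂ (~-elim ab~cd))

    cover : ∀ {δ} → δ ∈ allFin n → inRel G (a , b) (a , δ) ≡ true →
            Σ[ y ∈ Fin n ] y ∈ allFin n × inRel G (c , d) (c , y) ≡ true × u ⟨$⟩ δ ≡ y
    cover {δ} _ ab~aδ = u ⟨$⟩ δ , ∈-allFin _ ,
      ~⇒inRel (~-trans (~-sym ab~cd) (~-trans (inRel⇒~ ab~aδ) (~-intro u ua refl))) , refl

    fibre : ∀ {y} → y ∈ allFin n → _ → length (filter (λ δ → u ⟨$⟩ δ ≟ y) (allFin n)) ≤ 1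
    fibre _ _ = length-filter≤1 _ (allFin⁺ n) λ _ _ e e′ → ⟨$⟩-injective u (trans e (sym e′))

  valency-resp-~ : ∀ {p q} → p ~ q → valency G p ≡ valency G q
  valency-resp-~ {_ , _} {_ , _} p~q = ≤-antisym (valency-mono p~q) (valency-mono (~-sym p~q))

  valency≡1 : ∀ {a b} → Stab a ⊆′ Stab b → valency G (a , b) ≡ 1
  valency≡1 {a} {b} sub = ≤-antisym
    (length-filter≤1 (row? (a , b)) (allFin⁺ n) λ _ _ e e′ → trans (on-row e) (sym (on-row e′)))
    (1≤length-filter (row? (a , b)) (∈-allFin b) (~⇒inRel ~-refl))
    where
    on-row : ∀ {δ} → inRel G (a , b) (a , δ) ≡ true → δ ≡ b
    on-row e = let h , ha , hb = ~-elim (inRel⇒~ e) in trans (sym hb) (sub h ha)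

  valency≤maxValency : ∀ p → valency G p ≤ maxValency G
  valency≤maxValency p = let q , q∈ , q~p = basis-complete p in
    ≤-trans (≤-reflexive (valency-resp-~ (~-sym q~p))) (≤-maxList (∈-map⁺ (valency G) q∈))

  thin? : ∀ s → Dec (valency G s ≡ 1)
  thin? s = valency G s ℕ.≟ 1

  module _ (β γ : Fin n) where

    Blind : Fin n → Set
    Blind δ = (β , δ) ~ (γ , δ)

    blind? : ∀ δ → Dec (Blind δ)
    blind? δ = sameOrb? G (β , δ) (γ , δ)

    private
      Incident : Pair n → Fin n → Set
      Incident s δ = (inRel G s (β , δ) ∧ inRel G (star s) (δ , γ)) ≡ true

      incident? : ∀ s δ → Dec (Incident s δ)
      incident? s δ = (inRel G s (β , δ) ∧ inRel G (star s) (δ , γ)) Bool.≟ true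

      incident⇒~ : ∀ {s δ} → Incident s δ → s ~ (β , δ) × star s ~ (δ , γ)
      incident⇒~ e = let e₁ , e₂ = ∧-true e in inRel⇒~ e₁ , inRel⇒~ e₂

    sum-intersectionNumbers≤blind : sum (map (λ s → intersectionNumber G s (star s) (β , γ)) (basis G))
                                    ≤ length (filter blind? (allFin n))
    sum-intersectionNumbers≤blind = begin
      sum (map (λ s → length (filter (incident? s) (allFin n))) (basis G))          ≡⟨ sum-length-filter-comm incident? (basis G) (allFin n) ⟩
      sum (map (λ δ → length (filter (λ s → incident? s δ) (basis G))) (allFin n))  ≤⟨ sum≤length-filter* blind? _ 1 (allFin n) (λ _ → unique) (λ _ → blind) ⟩
      length (filter blind? (allFin n)) * 1                                          ≡⟨ *-identityʳ _ ⟩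
      length (filter blind? (allFin n))                                              ∎
      where
      open ≤-Reasoning
      unique : ∀ {δ} → length (filter (λ s → incident? s δ) (basis G)) ≤ 1
      unique = length-filter≤1 _ basis-nodup λ s∈ s′∈ i i′ →
        basis-unique s∈ s′∈ (~-trans (proj₁ (incident⇒~ i)) (~-sym (proj₁ (incident⇒~ i′))))
      blind : ∀ {δ} → 1 ≤ length (filter (λ s → incident? s δ) (basis G)) → Blind δ
      blind {δ} pos with witness-of-1≤length-filter (λ s → incident? s δ) (basis G) pos
      ... | (a , b) , _ , i = let ab~βδ , ba~δγ = incident⇒~ i in ~-trans (~-sym ab~βδ) (~-swap ba~δγ)

  module _ (transitive : Transitive G) {α} (ti : IsTIStab G α) where

    Stab⊆-count≤numThin : ∀ a → length (filter (Stab⊆? a) (allFin n)) ≤ numThin G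
    Stab⊆-count≤numThin a = ≤-trans
      (double-counting (Stab⊆? a) thin? (λ x s → Stab⊆? a x ×-dec sameOrb? G s (a , x)) (allFin n) (basis G) 1 cover fibre)
      (≤-reflexive (*-identityʳ _))
      where
      cover : ∀ {x} → x ∈ allFin n → Stab a ⊆′ Stab x →
              Σ[ s ∈ Pair n ] s ∈ basis G × valency G s ≡ 1 × Stab a ⊆′ Stab x × s ~ (a , x)
      cover {x} _ sub = let s , s∈ , s~ax = basis-complete (a , x) in
        s , s∈ , trans (valency-resp-~ {s} {a , x} s~ax) (valency≡1 {a} {x} sub) , sub , s~ax

      fibre : ∀ {s} → s ∈ basis G → valency G s ≡ 1 →
              length (filter (λ x → Stab⊆? a x ×-dec sameOrb? G s (a , x)) (allFin n)) ≤ 1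
      fibre _ _ = length-filter≤1 _ (allFin⁺ n) λ _ _ (sub , s~ax) (_ , s~ax′) →
        let h , ha , hx = ~-elim (~-trans (~-sym s~ax) s~ax′) in trans (sym (sub h ha)) hx

    module _ {β γ : Fin n} (β≢γ : β ≢ γ) {δ₀} (blind₀ : Blind β γ δ₀) where

      private
        g₀ = proj₁ (~-elim blind₀)
        g₀β = proj₁ (proj₂ (~-elim blind₀))
        g₀δ₀ = proj₂ (proj₂ (~-elim blind₀))

      Carries : Fin n → Fin n → Set
      Carries x y = Any (λ g → g ⟨$⟩ʳ β ≡ γ × g ⟨$⟩ʳ x ≡ x × g ⟨$⟩ʳ y ≡ δ₀) G

      carries? : ∀ x y → Dec (Carries x y)
      carries? x y = any? (λ g → (g ⟨$⟩ʳ β ≟ γ) ×-dec (g ⟨$⟩ʳ x ≟ x) ×-dec (g ⟨$⟩ʳ y ≟ δ₀)) G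

      carrier : ∀ {x y} → Carries x y → Σ[ g ∈ Element ] g ⟨$⟩ β ≡ γ × g ⟨$⟩ x ≡ x × g ⟨$⟩ y ≡ δ₀
      carrier c = let g , g∈ , e = find c in (g , g∈) , e

      Stab-δ₀∩Stab-γ-trivial : Stab δ₀ ∩ Stab γ ⊆′ Trivial
      Stab-δ₀∩Stab-γ-trivial h with stabilisers-TI transitive ti δ₀ γ
      ... | inj₁ sub  = contradiction (⟨$⟩-injective g₀ (trans g₀β (sym (sub g₀ g₀δ₀)))) β≢γ
      ... | inj₂ triv = triv h

      carriers-agree : ∀ {y} (g g₁ : Element) → g ⟨$⟩ β ≡ γ → g₁ ⟨$⟩ β ≡ γ → g ⟨$⟩ y ≡ δ₀ → g₁ ⟨$⟩ y ≡ δ₀ →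
                       ∀ j → g₁ ⟨$⟩ j ≡ g ⟨$⟩ j
      carriers-agree g g₁ gβ g₁β gy g₁y j = begin
        g₁ ⟨$⟩ j                    ≡⟨ cong (g₁ ⟨$⟩_) (⁻¹-cancelˡ g) ⟨
        g₁ ⟨$⟩ (g ⁻¹ ⟨$⟩ (g ⟨$⟩ j))  ≡⟨ ∘ᴳ-⟨$⟩ g₁ (g ⁻¹) _ ⟨
        (g₁ ∘ᴳ g ⁻¹) ⟨$⟩ (g ⟨$⟩ j)   ≡⟨ Stab-δ₀∩Stab-γ-trivial (g₁ ∘ᴳ g ⁻¹) (fixes gy g₁y , fixes gβ g₁β) (g ⟨$⟩ j) ⟩
        g ⟨$⟩ j                     ∎
        where
        open ≡-Reasoning
        fixes : ∀ {i k} → g ⟨$⟩ i ≡ k → g₁ ⟨$⟩ i ≡ k → (g₁ ∘ᴳ g ⁻¹) ⟨$⟩ k ≡ k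
        fixes gi g₁i = trans (∘ᴳ-⟨$⟩ g₁ (g ⁻¹) _) (trans (cong (g₁ ⟨$⟩_) (⁻¹-flip g gi)) g₁i)

      Stab⊆-of-common-fibre : ∀ {x x₁ y} → Carries x y → Carries x₁ y → Stab x₁ ⊆′ Stab x
      Stab⊆-of-common-fibre {x} {x₁} c c₁ with carrier c | carrier c₁ | stabilisers-TI transitive ti x₁ x
      ... | _ | _ | inj₁ sub = sub
      ... | g , gβ , gx , gy | g₁ , g₁β , g₁x₁ , g₁y | inj₂ triv =
        contradiction (trans (sym (triv g₁ (g₁x₁ , g₁x) β)) g₁β) β≢γ
        where g₁x = trans (carriers-agree g g₁ gβ g₁β gy g₁y x) gx

      fibre≤numThin : ∀ y → length (filter (λ x → carries? x y) (allFin n)) ≤ numThin G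
      fibre≤numThin y = length-filter≤-from-witness _ (allFin n) λ {x₁} _ c₁ →
        ≤-trans (length-filter-mono _ (Stab⊆? x₁) (allFin n) λ _ c → Stab⊆-of-common-fibre c c₁)
                (Stab⊆-count≤numThin x₁)

      blind-cover : ∀ {x} → x ∈ allFin n → Blind β γ x →
                    Σ[ y ∈ Fin n ] y ∈ allFin n × inRel G (β , δ₀) (β , y) ≡ true × Carries x y
      blind-cover _ blind with ~-elim blind
      ... | g , gβ , gx = g ⁻¹ ⟨$⟩ δ₀ , ∈-allFin _ , ~⇒inRel (~-intro (g ⁻¹ ∘ᴳ g₀) hβ hδ₀) ,
                          lose (proj₂ g) (gβ , gx , ⁻¹-cancelʳ g)
        where
        hβ = trans (∘ᴳ-⟨$⟩ (g ⁻¹) g₀ β) (trans (cong (g ⁻¹ ⟨$⟩_) g₀β) (⁻¹-flip g gβ))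
        hδ₀ = trans (∘ᴳ-⟨$⟩ (g ⁻¹) g₀ δ₀) (cong (g ⁻¹ ⟨$⟩_) g₀δ₀)

      blind-count≤valency*numThin : length (filter (blind? β γ) (allFin n)) ≤ valency G (β , δ₀) * numThin G
      blind-count≤valency*numThin = double-counting (blind? β γ) (row? (β , δ₀)) carries? (allFin n) (allFin n)
                                                    (numThin G) blind-cover (λ _ _ → fibre≤numThin _)

    blind-count≤numThin*maxValency : ∀ {β γ} → β ≢ γ → length (filter (blind? β γ) (allFin n)) ≤ numThin G * maxValency G
    blind-count≤numThin*maxValency {β} {γ} β≢γ = length-filter≤-from-witness (blind? β γ) (allFin n) λ {δ₀} _ blind₀ → begin
      length (filter (blind? β γ) (allFin n))  ≤⟨ blind-count≤valency*numThin β≢γ blind₀ ⟩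
      valency G (β , δ₀) * numThin G          ≤⟨ *-monoˡ-≤ (numThin G) (valency≤maxValency _) ⟩
      maxValency G * numThin G                ≡⟨ *-comm (maxValency G) (numThin G) ⟩
      numThin G * maxValency G                ∎
      where open ≤-Reasoning

    indist≤numThin*maxValency : indist G ≤ numThin G * maxValency G
    indist≤numThin*maxValency = maxList≤ λ c∈ →
      let r , r∈ , c≡ = ∈-map⁻ sumOver {xs = offDiagonal} c∈ ; _ , off = ∈-filter⁻ offDiagonal? {xs = basis G} r∈ in
      subst (_≤ _) (sym c≡) (bound r off)
      where
      sumOver : Pair n → ℕ
      sumOver r = sum (map (λ s → intersectionNumber G s (star s) r) (basis G))
      offDiagonal? : ∀ r → Dec (isDiag r ≡ false)
      offDiagonal? r = isDiag r Bool.≟ false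
      offDiagonal = filter offDiagonal? (basis G)
      bound : ∀ r → isDiag r ≡ false → sumOver r ≤ numThin G * maxValency G
      bound (β , γ) off = ≤-trans (sum-intersectionNumbers≤blind β γ) (blind-count≤numThin*maxValency (isDiag≡false⇒≢ off))

-- The fallback value is never used when f is a bijection, which is what fromImages checks.
invert : ∀ {n} → (Fin n → Fin n) → Fin n → Fin n
invert f i with Fin.any? (λ j → f j ≟ i)
... | yes (j , _) = j
... | no _        = i

inverse? : ∀ {n} (f : Fin n → Fin n) → Dec ((∀ i → f (invert f i) ≡ i) × (∀ i → invert f (f i) ≡ i))
inverse? f = Fin.all? (λ i → f (invert f i) ≟ i) ×-dec Fin.all? (λ i → invert f (f i) ≟ i)

fromImages : ∀ {n} (τ : Vec (Fin n) n) → {True (inverse? (lookup τ))} → Perm n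
fromImages τ {ok} = let invˡ , invʳ = toWitness ok in permutation (lookup τ) (invert (lookup τ)) invˡ invʳ

≗ₚ-⟨$⟩ˡ : ∀ {n} {g h : Perm n} → g ≗ₚ h → ∀ i → g ⟨$⟩ˡ i ≡ h ⟨$⟩ˡ i
≗ₚ-⟨$⟩ˡ {g = g} {h} g≗h i = begin
  g ⟨$⟩ˡ i                     ≡⟨ inverseˡ h ⟨
  h ⟨$⟩ˡ (h ⟨$⟩ʳ (g ⟨$⟩ˡ i))  ≡⟨ cong (h ⟨$⟩ˡ_) (g≗h _) ⟨
  h ⟨$⟩ˡ (g ⟨$⟩ʳ (g ⟨$⟩ˡ i))  ≡⟨ cong (h ⟨$⟩ˡ_) (inverseʳ g) ⟩
  h ⟨$⟩ˡ i                     ∎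
  where open ≡-Reasoning

module _ {n} (G : List (Perm n)) where

  ∈G? : ∀ f → Dec (f ∈G G)
  ∈G? f = any? (λ g → Fin.all? (λ i → g ⟨$⟩ʳ i ≟ f i)) G

  ∈G-resp : ∀ {f f′} → (∀ i → f i ≡ f′ i) → f ∈G G → f′ ∈G G
  ∈G-resp f≗f′ = Any.map λ g≗f i → trans (g≗f i) (f≗f′ i)

  ClosedUnderOperations : Set
  ClosedUnderOperations = (λ i → i) ∈G G ×
    All (λ g → All (λ h → (λ i → g ⟨$⟩ʳ (h ⟨$⟩ʳ i)) ∈G G) G × (g ⟨$⟩ˡ_) ∈G G) G

  closedUnderOperations? : Dec ClosedUnderOperations
  closedUnderOperations? = (∈G? (λ i → i)) ×-dec
    all? (λ g → all? (λ h → ∈G? (λ i → g ⟨$⟩ʳ (h ⟨$⟩ʳ i))) G ×-dec (∈G? (g ⟨$⟩ˡ_))) G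

  isPermGroup : ClosedUnderOperations → IsPermGroup G
  isPermGroup (id∈ , closed) = record { has-id = id∈ ; has-mul = mul ; has-inv = inv }
    where
    mul : ∀ g h → Any (g ≗ₚ_) G → Any (h ≗ₚ_) G → (λ i → g ⟨$⟩ʳ (h ⟨$⟩ʳ i)) ∈G G
    mul g h g∈ h∈ = ∈G-resp g′h′≗gh g′h′∈
      where
      g′ = Any.lookup g∈
      h′ = Any.lookup h∈
      g′∘-∈ = proj₁ (proj₁ (All.lookupAny closed g∈))
      g≗g′ = proj₂ (All.lookupAny closed g∈)
      g′h′∈ = proj₁ (All.lookupAny g′∘-∈ h∈)
      h≗h′ = proj₂ (All.lookupAny g′∘-∈ h∈)
      g′h′≗gh : ∀ i → g′ ⟨$⟩ʳ (h′ ⟨$⟩ʳ i) ≡ g ⟨$⟩ʳ (h ⟨$⟩ʳ i)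
      g′h′≗gh i = trans (cong (g′ ⟨$⟩ʳ_) (sym (h≗h′ i))) (sym (g≗g′ _))

    inv : ∀ g → Any (g ≗ₚ_) G → (g ⟨$⟩ˡ_) ∈G G
    inv g g∈ = ∈G-resp (λ i → sym (≗ₚ-⟨$⟩ˡ {g = g} {Any.lookup g∈} (proj₂ (All.lookupAny closed g∈)) i))
                       (proj₂ (proj₁ (All.lookupAny closed g∈)))

  transitive? : Dec (Transitive G)
  transitive? = Fin.all? λ β → Fin.all? λ γ → any? (λ g → g ⟨$⟩ʳ β ≟ γ) G

  module _ (α : Fin n) where

    TIAt : Perm n → Set
    TIAt g = All (λ x → InStab α x → InConj α g x) G
           ⊎ All (λ x → InStab α x → InConj α g x → ∀ i → x ⟨$⟩ʳ i ≡ i) G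

    tiAt? : ∀ g → Dec (TIAt g)
    tiAt? g = all? (λ x → (x ⟨$⟩ʳ α ≟ α) →-dec (g ⟨$⟩ʳ (x ⟨$⟩ʳ (g ⟨$⟩ˡ α)) ≟ α)) G
         ⊎-dec all? (λ x → (x ⟨$⟩ʳ α ≟ α) →-dec ((g ⟨$⟩ʳ (x ⟨$⟩ʳ (g ⟨$⟩ˡ α)) ≟ α) →-dec Fin.all? (λ i → x ⟨$⟩ʳ i ≟ i))) G

    InConj-resp : ∀ {g g′ x x′} → g ≗ₚ g′ → x ≗ₚ x′ → InConj α g x → InConj α g′ x′
    InConj-resp {g} {g′} {x} {x′} g≗g′ x≗x′ conj = begin
      g′ ⟨$⟩ʳ (x′ ⟨$⟩ʳ (g′ ⟨$⟩ˡ α))  ≡⟨ cong (λ j → g′ ⟨$⟩ʳ (x′ ⟨$⟩ʳ j)) (≗ₚ-⟨$⟩ˡ {g = g} {g′} g≗g′ α) ⟨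
      g′ ⟨$⟩ʳ (x′ ⟨$⟩ʳ (g ⟨$⟩ˡ α))   ≡⟨ cong (g′ ⟨$⟩ʳ_) (x≗x′ _) ⟨
      g′ ⟨$⟩ʳ (x ⟨$⟩ʳ (g ⟨$⟩ˡ α))    ≡⟨ g≗g′ _ ⟨
      g ⟨$⟩ʳ (x ⟨$⟩ʳ (g ⟨$⟩ˡ α))     ≡⟨ conj ⟩
      α                               ∎
      where open ≡-Reasoning

    isTIStab : All TIAt G → IsTIStab G α
    isTIStab ti g g∈ with All.lookupAny ti g∈
    ... | inj₁ normal , g≗g′ = inj₁ λ x x∈ xα →
      let x-ok , x≗x′ = All.lookupAny normal x∈ in
      InConj-resp {Any.lookup g∈} {g} {Any.lookup x∈} {x} (λ i → sym (g≗g′ i)) (λ i → sym (x≗x′ i)) (x-ok (trans (sym (x≗x′ α)) xα))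
    ... | inj₂ trivial , g≗g′ = inj₂ λ x x∈ xα conj i →
      let x-ok , x≗x′ = All.lookupAny trivial x∈ in
      trans (x≗x′ i) (x-ok (trans (sym (x≗x′ α)) xα) (InConj-resp {g} {Any.lookup g∈} {x} {Any.lookup x∈} g≗g′ x≗x′ conj) i)

module A₄ where

  open import Agda.Builtin.FromNat using (Number; fromNat)
  import Data.Fin.Literals as Fin
  import Data.Nat.Literals as ℕ
  open import Data.Unit using (tt)
  open import Data.Vec using ([]; _∷_)

  instance
    ℕ-number : Number ℕ
    ℕ-number = ℕ.number

    Fin-number : ∀ {n} → Number (Fin n)
    Fin-number {n} = Fin.number n

  -- The points 0, …, 5 are the edges 01, 02, 03, 12, 13, 23; edge stabilisers have order 2,
  -- and here m = k = 2 while c = 4.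
  A₄-on-edges : List (Perm 6)
  A₄-on-edges =
    fromImages (0 ∷ 1 ∷ 2 ∷ 3 ∷ 4 ∷ 5 ∷ []) ∷
    fromImages (1 ∷ 2 ∷ 0 ∷ 5 ∷ 3 ∷ 4 ∷ []) ∷
    fromImages (2 ∷ 0 ∷ 1 ∷ 4 ∷ 5 ∷ 3 ∷ []) ∷
    fromImages (0 ∷ 4 ∷ 3 ∷ 2 ∷ 1 ∷ 5 ∷ []) ∷
    fromImages (3 ∷ 0 ∷ 4 ∷ 1 ∷ 5 ∷ 2 ∷ []) ∷
    fromImages (4 ∷ 3 ∷ 0 ∷ 5 ∷ 2 ∷ 1 ∷ []) ∷
    fromImages (1 ∷ 3 ∷ 5 ∷ 0 ∷ 2 ∷ 4 ∷ []) ∷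
    fromImages (3 ∷ 5 ∷ 1 ∷ 4 ∷ 0 ∷ 2 ∷ []) ∷
    fromImages (5 ∷ 1 ∷ 3 ∷ 2 ∷ 4 ∷ 0 ∷ []) ∷
    fromImages (2 ∷ 5 ∷ 4 ∷ 1 ∷ 0 ∷ 3 ∷ []) ∷
    fromImages (4 ∷ 2 ∷ 5 ∷ 0 ∷ 3 ∷ 1 ∷ []) ∷
    fromImages (5 ∷ 4 ∷ 2 ∷ 3 ∷ 1 ∷ 0 ∷ []) ∷ []

  A₄-tight : IsPermGroup A₄-on-edges × Transitive A₄-on-edges × IsTIStab A₄-on-edges 0 ×
             (indist A₄-on-edges ≡ numThin A₄-on-edges * maxValency A₄-on-edges)
  A₄-tight = isPermGroup A₄-on-edges (from-yes (closedUnderOperations? A₄-on-edges)) ,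
             from-yes (transitive? A₄-on-edges) ,
             isTIStab A₄-on-edges 0 (from-yes (all? (tiAt? A₄-on-edges 0) A₄-on-edges)) , refl

lemma3p4 : ((n : ℕ) (G : List (Perm n)) (α : Fin n) → IsPermGroup G → Transitive G → IsTIStab G α →
      indist G ≤ numThin G * maxValency G)
    × Σ ℕ (λ n → Σ (List (Perm n)) (λ G → Σ (Fin n) (λ α →
        IsPermGroup G × Transitive G × IsTIStab G α × (indist G ≡ numThin G * maxValency G))))
lemma3p4 = (λ _ _ _ isGroup transitive ti → Configuration.indist≤numThin*maxValency isGroup transitive ti)
         , 6 , A₄.A₄-on-edges , zero , A₄.A₄-tight
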